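{- Let $A$ be an $n\times n$ alternating sign matrix with $p=\sigma_-(A)$. Then there is a sequence of $n\times n$ alternating sign matrices $A^{(p)},A^{(p-1)},\dots,A^{(0)}$ such that (i) $A^{(p)}=A$, (ii) $A^{(0)}$ is a permutation matrix, (iii) $\sigma_-(A^{(s)})=s$ for $s=0,1,\dots,p$, and (iv) $h(A^{(p)})\preceq^* h(A^{(p-1)})\preceq^*\cdots\preceq^* h(A^{(0)})$.
   Context: An $n\times n$ alternating sign matrix (ASM) is a $(0,\pm1)$-matrix whose rows and columns each have nonzeros alternating in sign beginning and ending with $+1$. $\sigma_-(B)$ is the number of entries equal to $-1$ in $B$. For an $n\times n$ matrix $B$, $h(B)=B^Tz_n$ where $z_n=(n,n-1,\dots,1)^T$. For vectors $x,y\in\mathbb R^n$ (not necessarily monotone), $x\preceq^* y$ means $\sum_{j=1}^q x_j\le\sum_{j=1}^q y_j$ for all $q\le n$, with equality for $q=n$. -}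

module Defs where

open import Data.Nat using (ℕ; zero; suc; _∸_)
open import Data.Integer using (ℤ; +_; -[1+_]; _+_; _*_; _≤_)
open import Data.Fin using (Fin; toℕ)
open import Data.List using (List; []; _∷_; map; filter; length; allFin; take)
open import Data.Nat.ListAction using (sum)
open import Data.Product using (_×_)
open import Relation.Nullary using (¬_)
open import Relation.Binary.PropositionalEquality using (_≡_)
open import Data.Integer.Properties using () renaming (_≟_ to _≟ℤ_)
open import Relation.Nullary.Decidable using (¬?)

-- n × n integer matrices, indexed (row, column) by Fin n
Matrix : ℕ → Set
Matrix n = Fin n → Fin n → ℤ

IsSignEntry : ℤ → Set
IsSignEntry x = (x ≡ + 0) Data.Sum.⊎ ((x ≡ + 1) Data.Sum.⊎ (x ≡ -[1+ 0 ]))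
  where import Data.Sum

data Alternating : List ℤ → Set where
  alt-one  : Alternating (+ 1 ∷ [])
  alt-cons : ∀ {xs} → Alternating xs → Alternating (+ 1 ∷ -[1+ 0 ] ∷ xs)

nonzeros : ∀ {n} → (Fin n → ℤ) → List ℤ
nonzeros {n} v = filter (λ x → ¬? (x ≟ℤ + 0)) (map v (allFin n))

row : ∀ {n} → Matrix n → Fin n → (Fin n → ℤ)
row A i = λ j → A i j

col : ∀ {n} → Matrix n → Fin n → (Fin n → ℤ)
col A j = λ i → A i j

IsASM : ∀ {n} → Matrix n → Set
IsASM {n} A =
  (∀ i j → IsSignEntry (A i j))
  × ((i : Fin n) → Alternating (nonzeros (row A i)))
  × ((j : Fin n) → Alternating (nonzeros (col A j)))

count : List ℤ → ℤ → ℕ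
count xs a = length (filter (λ x → x ≟ℤ a) xs)

IsPermutationMatrix : ∀ {n} → Matrix n → Set
IsPermutationMatrix {n} A =
  (∀ i j → (A i j ≡ + 0) Data.Sum.⊎ (A i j ≡ + 1))
  × ((i : Fin n) → count (map (row A i) (allFin n)) (+ 1) ≡ 1)
  × ((j : Fin n) → count (map (col A j) (allFin n)) (+ 1) ≡ 1)
  where import Data.Sum

σ₋ : ∀ {n} → Matrix n → ℕ
σ₋ {n} A = sum (map (λ i → count (map (row A i) (allFin n)) -[1+ 0 ]) (allFin n))

sumℤ : List ℤ → ℤ
sumℤ [] = + 0
sumℤ (x ∷ xs) = x + sumℤ xs

-- z_n = (n, n-1, ..., 1); with 0-based index i, (z_n)_i = n - i
z : (n : ℕ) → Fin n → ℤ
z n i = + (n ∸ toℕ i)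

h : ∀ {n} → Matrix n → Fin n → ℤ
h {n} B j = sumℤ (map (λ i → B i j * z n i) (allFin n))

_⪯*_ : ∀ {n} → (Fin n → ℤ) → (Fin n → ℤ) → Set
_⪯*_ {n} x y =
  ((q : ℕ) → q Data.Nat.≤ n →
     sumℤ (take q (map x (allFin n))) ≤ sumℤ (take q (map y (allFin n))))
  × (sumℤ (map x (allFin n)) ≡ sumℤ (map y (allFin n)))
  where import Data.Nat

-- A line (row or column) with entries in {0,±1} is alternating iff all its prefix
-- sums are 0 or 1 and its total is 1.  Let c be the topmost row containing a −1,
-- at column d.  The nearest nonzero entry above (c,d) is a +1, at row a, and the
-- nearest nonzero entry to the left of (c,d) is a +1, at column b.  Adding the
-- rank-one "rectangle" (e_a − e_c)(e_b − e_d)ᵀ shifts the prefix sums of rows a, c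
-- and columns b, d by ±1 on a window where they are 0 (resp. 1) — rows above c are
-- −1-free, which is what makes this work for row a and column b — so the result is
-- an ASM with one −1 fewer.  It changes h by (z_a − z_c)(e_b − e_d), a nonnegative
-- multiple of a vector with nonnegative prefix sums and total 0, so h goes up in ⪯*.
-- Iterating gives the chain; an ASM without −1 is a permutation matrix.
module Submission where

open import Defs
open import Data.Nat as ℕ using (ℕ; zero; suc; z≤n; _≤?_)
import Data.Nat.Properties as ℕP
open import Data.Nat.ListAction using (sum)
open import Data.Integer as ℤ using (ℤ; +_; -[1+_]; _+_; _*_; _-_; +≤+; 0ℤ; 1ℤ; -1ℤ)
import Data.Integer.Properties as ℤP
open import Data.Integer.Solver using (module +-*-Solver)
open import Data.Fin using (Fin; toℕ; fromℕ; fromℕ<; inject₁; inject; opposite)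
open import Data.Fin using () renaming (zero to fzero; suc to fsuc)
import Data.Fin.Properties as FinP
open import Data.List using (List; []; _∷_; map; filter; take; allFin)
import Data.List.Properties as ListP
open import Data.Product using (Σ; _×_; _,_; proj₁; proj₂)
open import Data.Sum using (_⊎_; inj₁; inj₂)
open import Data.Empty using (⊥-elim)
open import Function using (_∘_)
open import Relation.Nullary using (¬_; yes; no)
open import Relation.Nullary.Decidable using (¬?)
open import Relation.Binary.PropositionalEquality
open ≡-Reasoning
open +-*-Solver using (solve; _:+_; _:-_; _:*_; _:=_; con)

Bit : ℤ → Set
Bit x = (x ≡ 0ℤ) ⊎ (x ≡ 1ℤ)

ps : ∀ {n} → (Fin n → ℤ) → ℕ → ℤ
ps {n} v k = sumℤ (take k (map v (allFin n)))

tot : ∀ {n} → (Fin n → ℤ) → ℤ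
tot {n} v = sumℤ (map v (allFin n))

map-allFin-suc : ∀ {n} {X : Set} (v : Fin (suc n) → X) →
  map v (allFin (suc n)) ≡ v fzero ∷ map (v ∘ fsuc) (allFin n)
map-allFin-suc v = cong (v fzero ∷_)
  (trans (ListP.map-tabulate fsuc v) (sym (ListP.map-tabulate (λ i → i) (v ∘ fsuc))))

ps-suc : ∀ {n} (v : Fin (suc n) → ℤ) k → ps v (suc k) ≡ v fzero + ps (v ∘ fsuc) k
ps-suc v k = cong (λ xs → sumℤ (take (suc k) xs)) (map-allFin-suc v)

tot-suc : ∀ {n} (v : Fin (suc n) → ℤ) → tot v ≡ v fzero + tot (v ∘ fsuc)
tot-suc v = cong sumℤ (map-allFin-suc v)

ps-total : ∀ {n} (v : Fin n → ℤ) → ps v n ≡ tot v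
ps-total {zero} v = refl
ps-total {suc n} v = begin
  ps v (suc n)               ≡⟨ ps-suc v n ⟩
  v fzero + ps (v ∘ fsuc) n  ≡⟨ cong (_+_ (v fzero)) (ps-total (v ∘ fsuc)) ⟩
  v fzero + tot (v ∘ fsuc)   ≡⟨ tot-suc v ⟨
  tot v                      ∎

ps-step : ∀ {n} (v : Fin n → ℤ) (i : Fin n) → ps v (suc (toℕ i)) ≡ ps v (toℕ i) + v i
ps-step v fzero = trans (ps-suc v 0) (ℤP.+-comm (v fzero) 0ℤ)
ps-step v (fsuc i) = begin
  ps v (suc (suc (toℕ i)))                          ≡⟨ ps-suc v (suc (toℕ i)) ⟩
  v fzero + ps (v ∘ fsuc) (suc (toℕ i))             ≡⟨ cong (_+_ (v fzero)) (ps-step (v ∘ fsuc) i) ⟩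
  v fzero + (ps (v ∘ fsuc) (toℕ i) + v (fsuc i))    ≡⟨ ℤP.+-assoc (v fzero) _ _ ⟨
  (v fzero + ps (v ∘ fsuc) (toℕ i)) + v (fsuc i)    ≡⟨ cong (_+ v (fsuc i)) (ps-suc v (toℕ i)) ⟨
  ps v (suc (toℕ i)) + v (fsuc i)                   ∎

ps-stepℕ : ∀ {n} (v : Fin n → ℤ) {m} (m<n : m ℕ.< n) → ps v (suc m) ≡ ps v m + v (fromℕ< m<n)
ps-stepℕ v m<n = subst (λ m → ps v (suc m) ≡ ps v m + v (fromℕ< m<n))
  (FinP.toℕ-fromℕ< m<n) (ps-step v (fromℕ< m<n))

sumℤ-update : ∀ {X : Set} (v t : X → ℤ) (ε : ℤ) xs →
  sumℤ (map (λ i → v i + ε * t i) xs) ≡ sumℤ (map v xs) + ε * sumℤ (map t xs)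
sumℤ-update v t ε [] = sym (cong (_+_ 0ℤ) (ℤP.*-zeroʳ ε))
sumℤ-update v t ε (x ∷ xs) = begin
  (v x + ε * t x) + sumℤ (map (λ i → v i + ε * t i) xs)
    ≡⟨ cong (_+_ (v x + ε * t x)) (sumℤ-update v t ε xs) ⟩
  (v x + ε * t x) + (sumℤ (map v xs) + ε * sumℤ (map t xs))
    ≡⟨ regroup (v x) (t x) ε _ _ ⟩
  (v x + sumℤ (map v xs)) + ε * (t x + sumℤ (map t xs))
    ∎
  where
  regroup : ∀ p q e r s → (p + e * q) + (r + e * s) ≡ (p + r) + e * (q + s)
  regroup = solve 5 (λ p q e r s → (p :+ e :* q) :+ (r :+ e :* s) := (p :+ r) :+ e :* (q :+ s)) refl

ps-as-map : ∀ {n} (v : Fin n → ℤ) k → ps v k ≡ sumℤ (map v (take k (allFin n)))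
ps-as-map {n} v k = cong sumℤ (ListP.take-map k (allFin n))

ps-update : ∀ {n} {v w : Fin n → ℤ} ε (t : Fin n → ℤ) → (∀ i → w i ≡ v i + ε * t i) →
  ∀ k → ps w k ≡ ps v k + ε * ps t k
ps-update {n} {v} {w} ε t w≡ k = begin
  ps w k                                          ≡⟨ ps-as-map w k ⟩
  sumℤ (map w prefix)                             ≡⟨ cong sumℤ (ListP.map-cong w≡ prefix) ⟩
  sumℤ (map (λ i → v i + ε * t i) prefix)         ≡⟨ sumℤ-update v t ε prefix ⟩
  sumℤ (map v prefix) + ε * sumℤ (map t prefix)
                                                  ≡⟨ cong₂ (λ x y → x + ε * y) (ps-as-map v k) (ps-as-map t k) ⟨
  ps v k + ε * ps t k                             ∎
  where
  prefix = take k (allFin n)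

tot-update : ∀ {n} {v w : Fin n → ℤ} ε (t : Fin n → ℤ) → (∀ i → w i ≡ v i + ε * t i) →
  tot w ≡ tot v + ε * tot t
tot-update {n} {v} {w} ε t w≡ = begin
  tot w                  ≡⟨ ps-total w ⟨
  ps w n                 ≡⟨ ps-update ε t w≡ n ⟩
  ps v n + ε * ps t n    ≡⟨ cong₂ (λ x y → x + ε * y) (ps-total v) (ps-total t) ⟩
  tot v + ε * tot t      ∎

unit : ∀ {n} → Fin n → Fin n → ℤ
unit fzero    fzero    = 1ℤ
unit fzero    (fsuc i) = 0ℤ
unit (fsuc a) fzero    = 0ℤ
unit (fsuc a) (fsuc i) = unit a i

unit-self : ∀ {n} (a : Fin n) → unit a a ≡ 1ℤ
unit-self fzero    = refl
unit-self (fsuc a) = unit-self a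

unit-other : ∀ {n} (a i : Fin n) → i ≢ a → unit a i ≡ 0ℤ
unit-other fzero    fzero    i≢a = ⊥-elim (i≢a refl)
unit-other fzero    (fsuc i) i≢a = refl
unit-other (fsuc a) fzero    i≢a = refl
unit-other (fsuc a) (fsuc i) i≢a = unit-other a i (i≢a ∘ cong fsuc)

ps-zero-vector : ∀ {n} k → ps {n} (λ _ → 0ℤ) k ≡ 0ℤ
ps-zero-vector {zero}  zero    = refl
ps-zero-vector {zero}  (suc k) = refl
ps-zero-vector {suc n} zero    = refl
ps-zero-vector {suc n} (suc k) =
  trans (ps-suc (λ _ → 0ℤ) k) (trans (ℤP.+-identityˡ _) (ps-zero-vector {n} k))

tot-zero-vector : ∀ {n} → tot {n} (λ _ → 0ℤ) ≡ 0ℤ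
tot-zero-vector {n} = trans (sym (ps-total {n} (λ _ → 0ℤ))) (ps-zero-vector {n} n)

ps-unit-before : ∀ {n} (a : Fin n) k → k ℕ.≤ toℕ a → ps (unit a) k ≡ 0ℤ
ps-unit-before a        zero    _         = refl
ps-unit-before (fsuc a) (suc k) (ℕ.s≤s k≤a) =
  trans (ps-suc (unit (fsuc a)) k) (trans (ℤP.+-identityˡ _) (ps-unit-before a k k≤a))

ps-unit-after : ∀ {n} (a : Fin n) k → toℕ a ℕ.< k → ps (unit a) k ≡ 1ℤ
ps-unit-after {suc n} fzero    (suc k) _ =
  trans (ps-suc (unit fzero) k) (cong (_+_ 1ℤ) (ps-zero-vector {n} k))
ps-unit-after         (fsuc a) (suc k) (ℕ.s≤s a<k) =
  trans (ps-suc (unit (fsuc a)) k) (trans (ℤP.+-identityˡ _) (ps-unit-after a k a<k))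

tot-unit-weighted : ∀ {n} (a : Fin n) (w : Fin n → ℤ) → tot (λ i → unit a i * w i) ≡ w a
tot-unit-weighted {suc n} fzero w = begin
  tot (λ i → unit fzero i * w i)     ≡⟨ tot-suc (λ i → unit fzero i * w i) ⟩
  1ℤ * w fzero + tot {n} (λ _ → 0ℤ)  ≡⟨ cong₂ _+_ (ℤP.*-identityˡ (w fzero)) (tot-zero-vector {n}) ⟩
  w fzero + 0ℤ                       ≡⟨ ℤP.+-identityʳ (w fzero) ⟩
  w fzero                            ∎
tot-unit-weighted {suc n} (fsuc a) w = trans (tot-suc (λ i → unit (fsuc a) i * w i))
  (trans (ℤP.+-identityˡ _) (tot-unit-weighted a (w ∘ fsuc)))

dipole : ∀ {n} → Fin n → Fin n → Fin n → ℤ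
dipole a c i = unit a i - unit c i

dipole-as-update : ∀ {n} (a c i : Fin n) → dipole a c i ≡ unit a i + -1ℤ * unit c i
dipole-as-update a c i = minus-as-update (unit a i) (unit c i)
  where
  minus-as-update : ∀ x y → x - y ≡ x + -1ℤ * y
  minus-as-update = solve 2 (λ x y → x :- y := x :+ con -1ℤ :* y) refl

-- The value of a dipole at its two poles and elsewhere, recorded so that matching on
-- it identifies the index with the pole.
data DipoleValue {n} (a c : Fin n) : Fin n → Set where
  at-plus   : dipole a c a ≡ 1ℤ  → DipoleValue a c a
  at-minus  : dipole a c c ≡ -1ℤ → DipoleValue a c c
  elsewhere : ∀ {i} → dipole a c i ≡ 0ℤ → DipoleValue a c i

dipole-plus : ∀ {n} {a c : Fin n} → a ≢ c → dipole a c a ≡ 1ℤ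
dipole-plus {a = a} {c} a≢c = cong₂ _-_ (unit-self a) (unit-other c a a≢c)

dipole-minus : ∀ {n} {a c : Fin n} → a ≢ c → dipole a c c ≡ -1ℤ
dipole-minus {a = a} {c} a≢c = cong₂ _-_ (unit-other a c (a≢c ∘ sym)) (unit-self c)

dipole-value : ∀ {n} {a c : Fin n} → a ≢ c → ∀ i → DipoleValue a c i
dipole-value {a = a} {c} a≢c i with i FinP.≟ a | i FinP.≟ c
... | yes refl | _        = at-plus (dipole-plus a≢c)
... | no _     | yes refl = at-minus (dipole-minus a≢c)
... | no i≢a   | no i≢c   = elsewhere (cong₂ _-_ (unit-other a i i≢a) (unit-other c i i≢c))

data Position (a c k : ℕ) : Set where
  before : k ℕ.≤ a → Position a c k
  inside : a ℕ.< k → k ℕ.≤ c → Position a c k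
  after  : c ℕ.< k → Position a c k

position : ∀ a c k → Position a c k
position a c k with k ≤? a | k ≤? c
... | yes k≤a | _       = before k≤a
... | no  k≰a | yes k≤c = inside (ℕP.≰⇒> k≰a) k≤c
... | no  _   | no  k≰c = after (ℕP.≰⇒> k≰c)

module _ {n} {a c : Fin n} (a<c : toℕ a ℕ.< toℕ c) where

  ps-dipole : ∀ k → ps (dipole a c) k ≡ ps (unit a) k + -1ℤ * ps (unit c) k
  ps-dipole = ps-update -1ℤ (unit c) (dipole-as-update a c)

  ps-dipole-before : ∀ {k} → k ℕ.≤ toℕ a → ps (dipole a c) k ≡ 0ℤ
  ps-dipole-before {k} k≤a = trans (ps-dipole k) (cong₂ (λ x y → x + -1ℤ * y)
    (ps-unit-before a k k≤a) (ps-unit-before c k (ℕP.≤-trans k≤a (ℕP.<⇒≤ a<c))))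

  ps-dipole-inside : ∀ {k} → toℕ a ℕ.< k → k ℕ.≤ toℕ c → ps (dipole a c) k ≡ 1ℤ
  ps-dipole-inside {k} a<k k≤c = trans (ps-dipole k) (cong₂ (λ x y → x + -1ℤ * y)
    (ps-unit-after a k a<k) (ps-unit-before c k k≤c))

  ps-dipole-after : ∀ {k} → toℕ c ℕ.< k → ps (dipole a c) k ≡ 0ℤ
  ps-dipole-after {k} c<k = trans (ps-dipole k) (cong₂ (λ x y → x + -1ℤ * y)
    (ps-unit-after a k (ℕP.<-trans a<c c<k)) (ps-unit-after c k c<k))

  ps-dipole-nonneg : ∀ k → 0ℤ ℤ.≤ ps (dipole a c) k
  ps-dipole-nonneg k with position (toℕ a) (toℕ c) k
  ... | before k≤a     = ℤP.≤-reflexive (sym (ps-dipole-before k≤a))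
  ... | inside a<k k≤c = subst (0ℤ ℤ.≤_) (sym (ps-dipole-inside a<k k≤c)) (+≤+ z≤n)
  ... | after c<k      = ℤP.≤-reflexive (sym (ps-dipole-after c<k))

  tot-dipole : tot (dipole a c) ≡ 0ℤ
  tot-dipole = trans (sym (ps-total (dipole a c))) (ps-dipole-after (FinP.toℕ<n c))

tot-dipole-weighted : ∀ {n} (a c : Fin n) (w : Fin n → ℤ) →
  tot (λ i → dipole a c i * w i) ≡ w a - w c
tot-dipole-weighted a c w = begin
  tot (λ i → dipole a c i * w i)
    ≡⟨ tot-update -1ℤ (λ i → unit c i * w i) (λ i → split (unit a i) (unit c i) (w i)) ⟩
  tot (λ i → unit a i * w i) + -1ℤ * tot (λ i → unit c i * w i)
    ≡⟨ cong₂ (λ x y → x + -1ℤ * y) (tot-unit-weighted a w) (tot-unit-weighted c w) ⟩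
  w a + -1ℤ * w c
    ≡⟨ unsplit (w a) (w c) ⟩
  w a - w c
    ∎
  where
  split : ∀ x y z → (x - y) * z ≡ x * z + -1ℤ * (y * z)
  split = solve 3 (λ x y z → (x :- y) :* z := x :* z :+ con -1ℤ :* (y :* z)) refl
  unsplit : ∀ x y → x + -1ℤ * y ≡ x - y
  unsplit = solve 2 (λ x y → x :+ con -1ℤ :* y := x :- y) refl

no-bit-large : ∀ {m} → ¬ Bit (+ suc (suc m))
no-bit-large (inj₁ ())
no-bit-large (inj₂ ())

no-bit-negative : ∀ {m} → ¬ Bit -[1+ m ]
no-bit-negative (inj₁ ())
no-bit-negative (inj₂ ())

record Walk (s : ℤ) (xs : List ℤ) : Set where
  constructor walk
  field
    heights : ∀ k → Bit (s + sumℤ (take k xs))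
    ends    : s + sumℤ xs ≡ 1ℤ

walk-start : ∀ {s xs} → Walk s xs → Bit s
walk-start {s} (walk heights _) = subst Bit (ℤP.+-identityʳ s) (heights 0)

walk-tail : ∀ {s x xs} → Walk s (x ∷ xs) → Walk (s + x) xs
walk-tail {s} {x} {xs} (walk heights ends) =
  walk (λ k → subst Bit (sym (ℤP.+-assoc s x _)) (heights (suc k)))
       (trans (ℤP.+-assoc s x (sumℤ xs)) ends)

walk-cons : ∀ {s x xs} → Bit s → Walk (s + x) xs → Walk s (x ∷ xs)
walk-cons {s} {x} {xs} bit (walk heights ends) =
  walk heights′ (trans (sym (ℤP.+-assoc s x (sumℤ xs))) ends)
  where
  heights′ : ∀ k → Bit (s + sumℤ (take k (x ∷ xs)))
  heights′ zero    = subst Bit (sym (ℤP.+-identityʳ s)) bit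
  heights′ (suc k) = subst Bit (ℤP.+-assoc s x _) (heights k)

nonzero : List ℤ → List ℤ
nonzero = filter (λ x → ¬? (x ℤP.≟ 0ℤ))

data AfterPlus : List ℤ → Set where
  stop     : AfterPlus []
  continue : ∀ {xs} → Alternating xs → AfterPlus (-1ℤ ∷ xs)

after-plus : ∀ {y ys} → Alternating (y ∷ ys) → AfterPlus ys
after-plus alt-one      = stop
after-plus (alt-cons a) = continue a

plus-then : ∀ {ys} → AfterPlus ys → Alternating (1ℤ ∷ ys)
plus-then stop         = alt-one
plus-then (continue a) = alt-cons a

mutual
  alternating→walk : ∀ xs → Alternating (nonzero xs) → Walk 0ℤ xs
  alternating→walk []                     ()
  alternating→walk (+ 0 ∷ xs)             a = walk-cons (inj₁ refl) (alternating→walk xs a)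
  alternating→walk (+ 1 ∷ xs)             a = walk-cons (inj₁ refl) (afterPlus→walk xs (after-plus a))
  alternating→walk (+ suc (suc m) ∷ xs)   ()
  alternating→walk (-[1+ m ] ∷ xs)        ()

  afterPlus→walk : ∀ xs → AfterPlus (nonzero xs) → Walk 1ℤ xs
  afterPlus→walk []                   stop = walk (λ { zero → inj₂ refl ; (suc k) → inj₂ refl }) refl
  afterPlus→walk (+ 0 ∷ xs)           a    = walk-cons (inj₂ refl) (afterPlus→walk xs a)
  afterPlus→walk (+ suc m ∷ xs)       ()
  afterPlus→walk (-[1+ 0 ] ∷ xs)      (continue a) = walk-cons (inj₂ refl) (alternating→walk xs a)
  afterPlus→walk (-[1+ suc m ] ∷ xs)  ()

mutual
  walk→alternating : ∀ xs → Walk 0ℤ xs → Alternating (nonzero xs)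
  walk→alternating []                   (walk _ ())
  walk→alternating (+ 0 ∷ xs)           w = walk→alternating xs (walk-tail w)
  walk→alternating (+ 1 ∷ xs)           w = plus-then (walk→afterPlus xs (walk-tail w))
  walk→alternating (+ suc (suc m) ∷ xs) w = ⊥-elim (no-bit-large (walk-start (walk-tail w)))
  walk→alternating (-[1+ m ] ∷ xs)      w = ⊥-elim (no-bit-negative (walk-start (walk-tail w)))

  walk→afterPlus : ∀ xs → Walk 1ℤ xs → AfterPlus (nonzero xs)
  walk→afterPlus []                   w = stop
  walk→afterPlus (+ 0 ∷ xs)           w = walk→afterPlus xs (walk-tail w)
  walk→afterPlus (+ suc m ∷ xs)       w = ⊥-elim (no-bit-large (walk-start (walk-tail w)))
  walk→afterPlus (-[1+ 0 ] ∷ xs)      w = continue (walk→alternating xs (walk-tail w))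
  walk→afterPlus (-[1+ suc m ] ∷ xs)  w = ⊥-elim (no-bit-negative (walk-start (walk-tail w)))

AltLine : ∀ {n} → (Fin n → ℤ) → Set
AltLine v = (∀ k → Bit (ps v k)) × tot v ≡ 1ℤ

alternating→altLine : ∀ {n} (v : Fin n → ℤ) → Alternating (nonzeros v) → AltLine v
alternating→altLine {n} v a with alternating→walk (map v (allFin n)) a
... | walk heights ends =
  (λ k → subst Bit (ℤP.+-identityˡ _) (heights k)) , trans (sym (ℤP.+-identityˡ _)) ends

altLine→alternating : ∀ {n} (v : Fin n → ℤ) → AltLine v → Alternating (nonzeros v)
altLine→alternating {n} v (bits , total) = walk→alternating (map v (allFin n))
  (walk (λ k → subst Bit (sym (ℤP.+-identityˡ _)) (bits k)) (trans (ℤP.+-identityˡ _) total))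

bit-step-sign : ∀ {p y} → Bit p → Bit (p + y) → IsSignEntry y
bit-step-sign {y = + 0}           _           _ = inj₁ refl
bit-step-sign {y = + 1}           (inj₁ refl) _ = inj₂ (inj₁ refl)
bit-step-sign {y = + suc (suc m)} (inj₁ refl) b = ⊥-elim (no-bit-large b)
bit-step-sign {y = + suc m}       (inj₂ refl) b = ⊥-elim (no-bit-large b)
bit-step-sign {y = -[1+ 0 ]}      (inj₁ refl) b = ⊥-elim (no-bit-negative b)
bit-step-sign {y = -[1+ 0 ]}      (inj₂ refl) _ = inj₂ (inj₂ refl)
bit-step-sign {y = -[1+ suc m ]}  (inj₁ refl) b = ⊥-elim (no-bit-negative b)
bit-step-sign {y = -[1+ suc m ]}  (inj₂ refl) b = ⊥-elim (no-bit-negative b)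

bit-step-down : ∀ {p} → Bit p → Bit (p + -1ℤ) → p ≡ 1ℤ
bit-step-down (inj₁ refl) b = ⊥-elim (no-bit-negative b)
bit-step-down (inj₂ refl) _ = refl

bit-step-up : ∀ {p} → Bit p → Bit (p + 1ℤ) → p ≡ 0ℤ
bit-step-up (inj₁ refl) _ = refl
bit-step-up (inj₂ refl) b = ⊥-elim (no-bit-large b)

bit-nonneg-step-zero : ∀ {p y} → Bit p → 0ℤ ℤ.≤ y → p + y ≡ 0ℤ → p ≡ 0ℤ
bit-nonneg-step-zero (inj₁ refl) _ _ = refl
bit-nonneg-step-zero (inj₂ refl) (+≤+ _) ()

heights-around : ∀ {n} {v : Fin n → ℤ} → AltLine v →
  ∀ i → Bit (ps v (toℕ i)) × Bit (ps v (toℕ i) + v i)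
heights-around {v = v} (bits , _) i = bits (toℕ i) , subst Bit (ps-step v i) (bits (suc (toℕ i)))

altLine-signs : ∀ {n} {v : Fin n → ℤ} → AltLine v → ∀ i → IsSignEntry (v i)
altLine-signs alt i = bit-step-sign (proj₁ (heights-around alt i)) (proj₂ (heights-around alt i))

altLine-before-minus : ∀ {n} {v : Fin n → ℤ} → AltLine v →
  ∀ {i} → v i ≡ -1ℤ → ps v (toℕ i) ≡ 1ℤ
altLine-before-minus {v = v} alt {i} vi≡-1 with heights-around alt i
... | here , next = bit-step-down here (subst (λ x → Bit (ps v (toℕ i) + x)) vi≡-1 next)

altLine-before-plus : ∀ {n} {v : Fin n → ℤ} → AltLine v →
  ∀ {i} → v i ≡ 1ℤ → ps v (toℕ i) ≡ 0ℤ
altLine-before-plus {v = v} alt {i} vi≡1 with heights-around alt i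
... | here , next = bit-step-up here (subst (λ x → Bit (ps v (toℕ i) + x)) vi≡1 next)

OnWindow : ∀ {n} → (Fin n → ℤ) → ℕ → ℕ → ℤ → Set
OnWindow v a c x = ∀ k → a ℕ.< k → k ℕ.≤ c → ps v k ≡ x

last-plus-one : ∀ {n} (v : Fin n → ℤ) → (∀ k → Bit (ps v k)) →
  ∀ m → m ℕ.≤ n → ps v m ≡ 1ℤ →
  Σ (Fin n) λ b → toℕ b ℕ.< m × v b ≡ 1ℤ × OnWindow v (toℕ b) m 1ℤ
last-plus-one v bits zero    _   ()
last-plus-one v bits (suc m) m<n ps≡1 with bits m
... | inj₁ psm≡0 = b , subst (ℕ._< suc m) (sym b≡m) ℕP.≤-refl , vb≡1 , window
  where
  b = fromℕ< m<n
  b≡m = FinP.toℕ-fromℕ< m<n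
  vb≡1 : v b ≡ 1ℤ
  vb≡1 = begin
    v b              ≡⟨ ℤP.+-identityˡ (v b) ⟨
    0ℤ + v b         ≡⟨ cong (_+ v b) psm≡0 ⟨
    ps v m + v b     ≡⟨ ps-stepℕ v m<n ⟨
    ps v (suc m)     ≡⟨ ps≡1 ⟩
    1ℤ               ∎
  window : OnWindow v (toℕ b) (suc m) 1ℤ
  window k b<k k≤m+1 = subst (λ k → ps v k ≡ 1ℤ)
    (ℕP.≤-antisym (subst (ℕ._< k) b≡m b<k) k≤m+1) ps≡1
... | inj₂ psm≡1 with last-plus-one v bits m (ℕP.<⇒≤ m<n) psm≡1
...   | b , b<m , vb≡1 , window = b , ℕP.m<n⇒m<1+n b<m , vb≡1 , window′
  where
  window′ : OnWindow v (toℕ b) (suc m) 1ℤ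
  window′ k b<k k≤m+1 with ℕP.m≤n⇒m<n∨m≡n k≤m+1
  ... | inj₁ k<m+1 = window k b<k (ℕP.m<1+n⇒m≤n k<m+1)
  ... | inj₂ refl  = ps≡1

zero-prefix : ∀ {n} (v : Fin n → ℤ) → (∀ k → Bit (ps v k)) →
  ∀ m → m ℕ.≤ n → (∀ i → toℕ i ℕ.< m → 0ℤ ℤ.≤ v i) → ps v m ≡ 0ℤ →
  ∀ k → k ℕ.≤ m → ps v k ≡ 0ℤ
zero-prefix v bits zero    _   _      ps≡0 zero _ = ps≡0
zero-prefix v bits (suc m) m<n nonneg ps≡0 k k≤m+1 with ℕP.m≤n⇒m<n∨m≡n k≤m+1
... | inj₂ refl  = ps≡0
... | inj₁ k<m+1 = zero-prefix v bits m (ℕP.<⇒≤ m<n) (λ i i<m → nonneg i (ℕP.m<n⇒m<1+n i<m))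
                     psm≡0 k (ℕP.m<1+n⇒m≤n k<m+1)
  where
  psm≡0 : ps v m ≡ 0ℤ
  psm≡0 = bit-nonneg-step-zero (bits m)
    (nonneg (fromℕ< m<n) (subst (ℕ._< suc m) (sym (FinP.toℕ-fromℕ< m<n)) ℕP.≤-refl))
    (trans (sym (ps-stepℕ v m<n)) ps≡0)

perturb : ∀ {n} {v w : Fin n → ℤ} {l r : Fin n} (ε : ℤ) → AltLine v → toℕ l ℕ.< toℕ r →
  (∀ k → toℕ l ℕ.< k → k ℕ.≤ toℕ r → Bit (ps v k + ε)) →
  (∀ i → w i ≡ v i + ε * dipole l r i) → AltLine w
perturb {v = v} {w} {l} {r} ε (bits , total) l<r window w≡ = bits′ , total′
  where
  shift : ∀ k → ps w k ≡ ps v k + ε * ps (dipole l r) k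
  shift = ps-update ε (dipole l r) w≡
  unshifted : ∀ k → ps (dipole l r) k ≡ 0ℤ → ps w k ≡ ps v k
  unshifted k ps≡0 = begin
    ps w k                          ≡⟨ shift k ⟩
    ps v k + ε * ps (dipole l r) k  ≡⟨ cong (λ x → ps v k + ε * x) ps≡0 ⟩
    ps v k + ε * 0ℤ                 ≡⟨ cong (_+_ (ps v k)) (ℤP.*-zeroʳ ε) ⟩
    ps v k + 0ℤ                     ≡⟨ ℤP.+-identityʳ (ps v k) ⟩
    ps v k                          ∎
  bits′ : ∀ k → Bit (ps w k)
  bits′ k with position (toℕ l) (toℕ r) k
  ... | before k≤l     = subst Bit (sym (unshifted k (ps-dipole-before l<r k≤l))) (bits k)
  ... | after r<k      = subst Bit (sym (unshifted k (ps-dipole-after l<r r<k))) (bits k)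
  ... | inside l<k k≤r = subst Bit shifted (window k l<k k≤r)
    where
    shifted : ps v k + ε ≡ ps w k
    shifted = sym (begin
      ps w k                          ≡⟨ shift k ⟩
      ps v k + ε * ps (dipole l r) k  ≡⟨ cong (λ x → ps v k + ε * x) (ps-dipole-inside l<r l<k k≤r) ⟩
      ps v k + ε * 1ℤ                 ≡⟨ cong (_+_ (ps v k)) (ℤP.*-identityʳ ε) ⟩
      ps v k + ε                      ∎)
  total′ : tot w ≡ 1ℤ
  total′ = begin
    tot w                            ≡⟨ tot-update ε (dipole l r) w≡ ⟩
    tot v + ε * tot (dipole l r)     ≡⟨ cong (λ x → tot v + ε * x) (tot-dipole l<r) ⟩
    tot v + ε * 0ℤ                   ≡⟨ cong (_+_ (tot v)) (ℤP.*-zeroʳ ε) ⟩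
    tot v + 0ℤ                       ≡⟨ ℤP.+-identityʳ (tot v) ⟩
    tot v                            ≡⟨ total ⟩
    1ℤ                               ∎

raise-line : ∀ {n} {v w : Fin n → ℤ} {l r : Fin n} → AltLine v → toℕ l ℕ.< toℕ r →
  OnWindow v (toℕ l) (toℕ r) 0ℤ → (∀ i → w i ≡ v i + 1ℤ * dipole l r i) → AltLine w
raise-line alt l<r zeros = perturb 1ℤ alt l<r
  (λ k l<k k≤r → subst (λ x → Bit (x + 1ℤ)) (sym (zeros k l<k k≤r)) (inj₂ refl))

lower-line : ∀ {n} {v w : Fin n → ℤ} {l r : Fin n} → AltLine v → toℕ l ℕ.< toℕ r →
  OnWindow v (toℕ l) (toℕ r) 1ℤ → (∀ i → w i ≡ v i + -1ℤ * dipole l r i) → AltLine w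
lower-line alt l<r ones = perturb -1ℤ alt l<r
  (λ k l<k k≤r → subst (λ x → Bit (x + -1ℤ)) (sym (ones k l<k k≤r)) (inj₁ refl))

keep-line : ∀ {n} {v w t : Fin n → ℤ} → AltLine v → (∀ i → w i ≡ v i + 0ℤ * t i) → AltLine w
keep-line {v = v} {w} {t} (bits , total) w≡ =
  (λ k → subst Bit (sym (trans (ps-update 0ℤ t w≡ k) (ℤP.+-identityʳ (ps v k)))) (bits k)) ,
  trans (tot-update 0ℤ t w≡) (trans (ℤP.+-identityʳ (tot v)) total)

⪯*-update : ∀ {n} {x y : Fin n → ℤ} (Λ : ℤ) (t : Fin n → ℤ) → (∀ j → y j ≡ x j + Λ * t j) →
  0ℤ ℤ.≤ Λ → (∀ k → 0ℤ ℤ.≤ ps t k) → tot t ≡ 0ℤ → x ⪯* y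
⪯*-update {n} {x} {y} Λ t y≡ Λ≥0 t≥0 t≡0 = partial , total
  where
  nonneg-* : ∀ {p q} → 0ℤ ℤ.≤ p → 0ℤ ℤ.≤ q → 0ℤ ℤ.≤ p * q
  nonneg-* {+ p} {+ q} _ _ = subst (0ℤ ℤ.≤_) (ℤP.pos-* p q) (+≤+ z≤n)
  partial : ∀ q → q ℕ.≤ n → ps x q ℤ.≤ ps y q
  partial q _ = subst (ps x q ℤ.≤_) (sym (ps-update Λ t y≡ q))
    (subst (ℤ._≤ ps x q + Λ * ps t q) (ℤP.+-identityʳ (ps x q))
      (ℤP.+-monoʳ-≤ (ps x q) (nonneg-* Λ≥0 (t≥0 q))))
  total : tot x ≡ tot y
  total = sym (begin
    tot y                 ≡⟨ tot-update Λ t y≡ ⟩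
    tot x + Λ * tot t     ≡⟨ cong (λ s → tot x + Λ * s) t≡0 ⟩
    tot x + Λ * 0ℤ        ≡⟨ cong (_+_ (tot x)) (ℤP.*-zeroʳ Λ) ⟩
    tot x + 0ℤ            ≡⟨ ℤP.+-identityʳ (tot x) ⟩
    tot x                 ∎)

-- isNeg x is 1 if x = −1 and 0 otherwise, so that σ₋ is a double sum of isNeg.
isNeg : ℤ → ℕ
isNeg (+ _)          = 0
isNeg -[1+ zero ]    = 1
isNeg -[1+ suc _ ]   = 0

count-minus-ones : ∀ xs → count xs -1ℤ ≡ sum (map isNeg xs)
count-minus-ones []                   = refl
count-minus-ones (+ _ ∷ xs)           = count-minus-ones xs
count-minus-ones (-[1+ zero ] ∷ xs)   = cong suc (count-minus-ones xs)
count-minus-ones (-[1+ suc _ ] ∷ xs)  = count-minus-ones xs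

sign-not-minus : ∀ {x} → IsSignEntry x → isNeg x ≡ 0 → Bit x
sign-not-minus (inj₁ x≡0)        _ = inj₁ x≡0
sign-not-minus (inj₂ (inj₁ x≡1)) _ = inj₂ x≡1
sign-not-minus (inj₂ (inj₂ refl)) ()

bit-nonneg : ∀ {x} → Bit x → 0ℤ ℤ.≤ x
bit-nonneg (inj₁ refl) = +≤+ z≤n
bit-nonneg (inj₂ refl) = +≤+ z≤n

isNeg-nonneg : ∀ {x} → 0ℤ ℤ.≤ x → isNeg x ≡ 0
isNeg-nonneg (+≤+ _) = refl

isNeg-positive : ∀ {x} → isNeg x ≢ 0 → x ≡ -1ℤ
isNeg-positive {+ _}           ne = ⊥-elim (ne refl)
isNeg-positive { -[1+ zero ]}  _  = refl
isNeg-positive { -[1+ suc _ ]} ne = ⊥-elim (ne refl)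

sumF : ∀ {n} → (Fin n → ℕ) → ℕ
sumF {n} F = sum (map F (allFin n))

sumF-suc : ∀ {n} (F : Fin (suc n) → ℕ) → sumF F ≡ F fzero ℕ.+ sumF (F ∘ fsuc)
sumF-suc F = cong sum (map-allFin-suc F)

sumF-cong : ∀ {n} {F G : Fin n → ℕ} → (∀ i → F i ≡ G i) → sumF F ≡ sumF G
sumF-cong {n} F≡G = cong sum (ListP.map-cong F≡G (allFin n))

sumF-zero : ∀ {n} (F : Fin n → ℕ) → (∀ i → F i ≡ 0) → sumF F ≡ 0
sumF-zero {zero}  F _    = refl
sumF-zero {suc n} F F≡0 =
  trans (sumF-suc F) (cong₂ ℕ._+_ (F≡0 fzero) (sumF-zero (F ∘ fsuc) (F≡0 ∘ fsuc)))

sumF-zero⁻ : ∀ {n} (F : Fin n → ℕ) → sumF F ≡ 0 → ∀ i → F i ≡ 0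
sumF-zero⁻ F Σ≡0 fzero    = ℕP.m+n≡0⇒m≡0 (F fzero) (trans (sym (sumF-suc F)) Σ≡0)
sumF-zero⁻ F Σ≡0 (fsuc i) =
  sumF-zero⁻ (F ∘ fsuc) (ℕP.m+n≡0⇒n≡0 (F fzero) (trans (sym (sumF-suc F)) Σ≡0)) i

sumF-bump : ∀ {n} (F G : Fin n → ℕ) (c : Fin n) → (∀ i → i ≢ c → F i ≡ G i) → F c ≡ suc (G c) →
  sumF F ≡ suc (sumF G)
sumF-bump {suc n} F G fzero F≡G Fc = begin
  sumF F                              ≡⟨ sumF-suc F ⟩
  F fzero ℕ.+ sumF (F ∘ fsuc)         ≡⟨ cong₂ ℕ._+_ Fc (sumF-cong (λ i → F≡G (fsuc i) λ ())) ⟩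
  suc (G fzero ℕ.+ sumF (G ∘ fsuc))   ≡⟨ cong suc (sumF-suc G) ⟨
  suc (sumF G)                        ∎
sumF-bump {suc n} F G (fsuc c) F≡G Fc = begin
  sumF F                              ≡⟨ sumF-suc F ⟩
  F fzero ℕ.+ sumF (F ∘ fsuc)         ≡⟨ cong₂ ℕ._+_ (F≡G fzero λ ()) (sumF-bump (F ∘ fsuc) (G ∘ fsuc) c
                                           (λ i i≢c → F≡G (fsuc i) (i≢c ∘ FinP.suc-injective)) Fc) ⟩
  G fzero ℕ.+ suc (sumF (G ∘ fsuc))   ≡⟨ ℕP.+-suc (G fzero) _ ⟩
  suc (G fzero ℕ.+ sumF (G ∘ fsuc))   ≡⟨ cong suc (sumF-suc G) ⟨
  suc (sumF G)                        ∎

negatives-in-row : ∀ {n} → Matrix n → Fin n → ℕ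
negatives-in-row A i = sumF (λ j → isNeg (A i j))

σ₋-as-sum : ∀ {n} (A : Matrix n) → σ₋ A ≡ sumF (negatives-in-row A)
σ₋-as-sum {n} A = sumF-cong λ i → trans (count-minus-ones (map (row A i) (allFin n)))
                                         (cong sum (sym (ListP.map-∘ (allFin n))))

topmost-minus-one : ∀ {n} (A : Matrix n) → σ₋ A ≢ 0 →
  Σ (Fin n) λ c → Σ (Fin n) λ d →
    A c d ≡ -1ℤ × (∀ i → toℕ i ℕ.< toℕ c → ∀ j → isNeg (A i j) ≡ 0)
topmost-minus-one {n} A σ≢0
  with FinP.¬∀⟶∃¬-smallest n (λ i → negatives-in-row A i ≡ 0) (λ i → negatives-in-row A i ℕ.≟ 0)
         (λ none → σ≢0 (trans (σ₋-as-sum A) (sumF-zero _ none)))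
... | c , row-c≢0 , rows-above
  with FinP.¬∀⟶∃¬ n (λ j → isNeg (A c j) ≡ 0) (λ j → isNeg (A c j) ℕ.≟ 0)
         (λ none → row-c≢0 (sumF-zero _ none))
...   | d , Acd≢0 = c , d , isNeg-positive Acd≢0 , above
  where
  above : ∀ i → toℕ i ℕ.< toℕ c → ∀ j → isNeg (A i j) ≡ 0
  above i i<c = sumF-zero⁻ _ (subst (λ i → negatives-in-row A i ≡ 0) same-row (rows-above k))
    where
    k = fromℕ< i<c
    same-row : inject k ≡ i
    same-row = FinP.toℕ-injective (trans (FinP.toℕ-inject k) (FinP.toℕ-fromℕ< i<c))

IsASM→rows : ∀ {n} {A : Matrix n} → IsASM A → ∀ i → AltLine (row A i)
IsASM→rows {A = A} (_ , rows , _) i = alternating→altLine (row A i) (rows i)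

IsASM→cols : ∀ {n} {A : Matrix n} → IsASM A → ∀ j → AltLine (col A j)
IsASM→cols {A = A} (_ , _ , cols) j = alternating→altLine (col A j) (cols j)

lines→IsASM : ∀ {n} {A : Matrix n} →
  (∀ i → AltLine (row A i)) → (∀ j → AltLine (col A j)) → IsASM A
lines→IsASM rows cols =
  (λ i j → altLine-signs (rows i) j) ,
  (λ i → altLine→alternating _ (rows i)) ,
  (λ j → altLine→alternating _ (cols j))

<⇒≢ : ∀ {n} {a c : Fin n} → toℕ a ℕ.< toℕ c → a ≢ c
<⇒≢ a<c a≡c = ℕP.<-irrefl (cong toℕ a≡c) a<c

module Rectangle {n} (A : Matrix n) (asm : IsASM A) (c d : Fin n) (Acd≡-1 : A c d ≡ -1ℤ)
                 (above : ∀ i → toℕ i ℕ.< toℕ c → ∀ j → 0ℤ ℤ.≤ A i j) where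

  rows : ∀ i → AltLine (row A i)
  rows = IsASM→rows asm

  cols : ∀ j → AltLine (col A j)
  cols = IsASM→cols asm

  up-from-cd : Σ (Fin n) λ a →
    toℕ a ℕ.< toℕ c × A a d ≡ 1ℤ × OnWindow (col A d) (toℕ a) (toℕ c) 1ℤ
  up-from-cd = last-plus-one (col A d) (proj₁ (cols d)) (toℕ c) (ℕP.<⇒≤ (FinP.toℕ<n c))
                 (altLine-before-minus (cols d) Acd≡-1)

  left-from-cd : Σ (Fin n) λ b →
    toℕ b ℕ.< toℕ d × A c b ≡ 1ℤ × OnWindow (row A c) (toℕ b) (toℕ d) 1ℤ
  left-from-cd = last-plus-one (row A c) (proj₁ (rows c)) (toℕ d) (ℕP.<⇒≤ (FinP.toℕ<n d))
                   (altLine-before-minus (rows c) Acd≡-1)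

  a : Fin n
  a = proj₁ up-from-cd
  a<c : toℕ a ℕ.< toℕ c
  a<c = proj₁ (proj₂ up-from-cd)
  Aad≡1 : A a d ≡ 1ℤ
  Aad≡1 = proj₁ (proj₂ (proj₂ up-from-cd))
  col-d-ones : OnWindow (col A d) (toℕ a) (toℕ c) 1ℤ
  col-d-ones = proj₂ (proj₂ (proj₂ up-from-cd))

  b : Fin n
  b = proj₁ left-from-cd
  b<d : toℕ b ℕ.< toℕ d
  b<d = proj₁ (proj₂ left-from-cd)
  Acb≡1 : A c b ≡ 1ℤ
  Acb≡1 = proj₁ (proj₂ (proj₂ left-from-cd))
  row-c-ones : OnWindow (row A c) (toℕ b) (toℕ d) 1ℤ
  row-c-ones = proj₂ (proj₂ (proj₂ left-from-cd))

  -- Row a and column b are nonnegative up to the +1 at (a, d) resp. (c, b), so their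
  -- heights are 0 on the windows (b, d] resp. (a, c].
  row-a-zeros : OnWindow (row A a) (toℕ b) (toℕ d) 0ℤ
  row-a-zeros k _ k≤d = zero-prefix (row A a) (proj₁ (rows a)) (toℕ d) (ℕP.<⇒≤ (FinP.toℕ<n d))
    (λ j _ → above a a<c j) (altLine-before-plus (rows a) Aad≡1) k k≤d

  col-b-zeros : OnWindow (col A b) (toℕ a) (toℕ c) 0ℤ
  col-b-zeros k _ k≤c = zero-prefix (col A b) (proj₁ (cols b)) (toℕ c) (ℕP.<⇒≤ (FinP.toℕ<n c))
    (λ i i<c → above i i<c b) (altLine-before-plus (cols b) Acb≡1) k k≤c

  A′ : Matrix n
  A′ i j = A i j + dipole a c i * dipole b d j

  row-entry : ∀ {i ε} → dipole a c i ≡ ε → ∀ j → A′ i j ≡ A i j + ε * dipole b d j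
  row-entry {i} e j = cong (λ x → A i j + x * dipole b d j) e

  rows′ : ∀ i → AltLine (row A′ i)
  rows′ i with dipole-value (<⇒≢ a<c) i
  ... | at-plus ε≡1   = raise-line {l = b} {d} (rows a) b<d row-a-zeros (row-entry ε≡1)
  ... | at-minus ε≡-1 = lower-line {l = b} {d} (rows c) b<d row-c-ones (row-entry ε≡-1)
  ... | elsewhere ε≡0 = keep-line {t = dipole b d} (rows i) (row-entry ε≡0)

  column-entry : ∀ {j ε} → dipole b d j ≡ ε → ∀ i → A′ i j ≡ A i j + ε * dipole a c i
  column-entry {j} e i =
    cong (_+_ (A i j)) (trans (ℤP.*-comm (dipole a c i) (dipole b d j)) (cong (_* dipole a c i) e))

  cols′ : ∀ j → AltLine (col A′ j)
  cols′ j with dipole-value (<⇒≢ b<d) j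
  ... | at-plus ε≡1   = raise-line {l = a} {c} (cols b) a<c col-b-zeros (column-entry ε≡1)
  ... | at-minus ε≡-1 = lower-line {l = a} {c} (cols d) a<c col-d-ones (column-entry ε≡-1)
  ... | elsewhere ε≡0 = keep-line {t = dipole a c} (cols j) (column-entry ε≡0)

  asm′ : IsASM A′
  asm′ = lines→IsASM rows′ cols′

  -- Away from (c, d), A′ has a −1 exactly where A has one: the corners (a, b), (a, d),
  -- (c, b) of the rectangle hold a nonnegative entry, +1 and +1 in A, and the
  -- nonnegative entries (a, b) + 1, 0 and 0 in A′.
  minus-ones-kept : ∀ i j → ¬ (i ≡ c × j ≡ d) → isNeg (A′ i j) ≡ isNeg (A i j)
  minus-ones-kept i j not-cd with dipole-value (<⇒≢ a<c) i | dipole-value (<⇒≢ b<d) j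
  ... | elsewhere ε≡0 | _ = cong isNeg (trans (row-entry ε≡0 j) (ℤP.+-identityʳ (A i j)))
  ... | _ | elsewhere ε≡0 = cong isNeg (begin
    A i j + dipole a c i * dipole b d j  ≡⟨ cong (λ x → A i j + dipole a c i * x) ε≡0 ⟩
    A i j + dipole a c i * 0ℤ            ≡⟨ cong (_+_ (A i j)) (ℤP.*-zeroʳ (dipole a c i)) ⟩
    A i j + 0ℤ                           ≡⟨ ℤP.+-identityʳ (A i j) ⟩
    A i j                                ∎)
  ... | at-plus e₁ | at-plus e₂ =
    trans (isNeg-nonneg (subst (0ℤ ℤ.≤_) (sym A′ab) (ℤP.+-mono-≤ (above a a<c b) (+≤+ z≤n))))
          (sym (isNeg-nonneg (above a a<c b)))
    where
    A′ab : A′ a b ≡ A a b + 1ℤ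
    A′ab = cong₂ (λ x y → A a b + x * y) e₁ e₂
  ... | at-plus e₁ | at-minus e₂ =
    trans (cong isNeg (trans (cong₂ (λ x y → A a d + x * y) e₁ e₂) (cong (_+ -1ℤ) Aad≡1)))
          (sym (cong isNeg Aad≡1))
  ... | at-minus e₁ | at-plus e₂ =
    trans (cong isNeg (trans (cong₂ (λ x y → A c b + x * y) e₁ e₂) (cong (_+ -1ℤ) Acb≡1)))
          (sym (cong isNeg Acb≡1))
  ... | at-minus _ | at-minus _ = ⊥-elim (not-cd (refl , refl))

  A′cd≡0 : A′ c d ≡ 0ℤ
  A′cd≡0 = trans (cong₂ (λ x y → A c d + x * y) (dipole-minus (<⇒≢ a<c)) (dipole-minus (<⇒≢ b<d)))
                 (cong (_+ 1ℤ) Acd≡-1)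

  σ₋-drops : σ₋ A ≡ suc (σ₋ A′)
  σ₋-drops = begin
    σ₋ A                                ≡⟨ σ₋-as-sum A ⟩
    sumF (negatives-in-row A)           ≡⟨ sumF-bump _ _ c other-rows row-c ⟩
    suc (sumF (negatives-in-row A′))    ≡⟨ cong suc (σ₋-as-sum A′) ⟨
    suc (σ₋ A′)                         ∎
    where
    other-rows : ∀ i → i ≢ c → negatives-in-row A i ≡ negatives-in-row A′ i
    other-rows i i≢c = sumF-cong λ j → sym (minus-ones-kept i j (i≢c ∘ proj₁))
    row-c : negatives-in-row A c ≡ suc (negatives-in-row A′ c)
    row-c = sumF-bump _ _ d (λ j j≢d → sym (minus-ones-kept c j (j≢d ∘ proj₂)))
              (trans (cong isNeg Acd≡-1) (sym (cong (suc ∘ isNeg) A′cd≡0)))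

  h-change : ∀ j → h A′ j ≡ h A j + (z n a - z n c) * dipole b d j
  h-change j = begin
    h A′ j
      ≡⟨ tot-update (dipole b d j) (λ i → dipole a c i * z n i)
           (λ i → expand (A i j) (dipole a c i) (dipole b d j) (z n i)) ⟩
    h A j + dipole b d j * tot (λ i → dipole a c i * z n i)
      ≡⟨ cong (λ x → h A j + dipole b d j * x) (tot-dipole-weighted a c (z n)) ⟩
    h A j + dipole b d j * (z n a - z n c)
      ≡⟨ cong (_+_ (h A j)) (ℤP.*-comm (dipole b d j) _) ⟩
    h A j + (z n a - z n c) * dipole b d j
      ∎
    where
    expand : ∀ x u e w → (x + u * e) * w ≡ x * w + e * (u * w)
    expand = solve 4 (λ x u e w → (x :+ u :* e) :* w := x :* w :+ e :* (u :* w)) refl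

  -- z_a ≥ z_c and e_b − e_d has nonnegative prefix sums and total 0, so h rises.
  h-rises : h A ⪯* h A′
  h-rises = ⪯*-update (z n a - z n c) (dipole b d) h-change
    (ℤP.i≤j⇒0≤j-i (+≤+ (ℕP.∸-monoʳ-≤ n (ℕP.<⇒≤ a<c)))) (ps-dipole-nonneg b<d) (tot-dipole b<d)

reduce : ∀ {n} (A : Matrix n) → IsASM A → ∀ {p} → σ₋ A ≡ suc p →
  Σ (Matrix n) λ A′ → IsASM A′ × σ₋ A′ ≡ p × h A ⪯* h A′
reduce A asm σ≡ with topmost-minus-one A (λ σ≡0 → ℕP.1+n≢0 (trans (sym σ≡) σ≡0))
... | c , d , Acd≡-1 , above = A′ , asm′ , ℕP.suc-injective (trans (sym σ₋-drops) σ≡) , h-rises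
  where
  open Rectangle A asm c d Acd≡-1
    (λ i i<c j → bit-nonneg (sign-not-minus (proj₁ asm i j) (above i i<c j)))

count-ones : ∀ {n} (v : Fin n → ℤ) → (∀ j → Bit (v j)) → + count (map v (allFin n)) 1ℤ ≡ tot v
count-ones {zero}  v _    = refl
count-ones {suc n} v bits = begin
  + count (map v (allFin (suc n))) 1ℤ
    ≡⟨ cong (λ xs → + count xs 1ℤ) (map-allFin-suc v) ⟩
  + count (v fzero ∷ map (v ∘ fsuc) (allFin n)) 1ℤ
    ≡⟨ count-cons (bits fzero) ⟩
  v fzero + + count (map (v ∘ fsuc) (allFin n)) 1ℤ
    ≡⟨ cong (_+_ (v fzero)) (count-ones (v ∘ fsuc) (bits ∘ fsuc)) ⟩
  v fzero + tot (v ∘ fsuc)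
    ≡⟨ tot-suc v ⟨
  tot v
    ∎
  where
  count-cons : ∀ {x xs} → Bit x → + count (x ∷ xs) 1ℤ ≡ x + + count xs 1ℤ
  count-cons (inj₁ refl) = sym (ℤP.+-identityˡ _)
  count-cons (inj₂ refl) = refl

-- An ASM without −1 is a permutation matrix: its entries are 0/1 and each line sums to 1.
permutation : ∀ {n} (A : Matrix n) → IsASM A → σ₋ A ≡ 0 → IsPermutationMatrix A
permutation A asm σ≡0 = bits , (λ i → one-in (bits i) (IsASM→rows asm i))
                             , (λ j → one-in (λ i → bits i j) (IsASM→cols asm j))
  where
  bits : ∀ i j → Bit (A i j)
  bits i j = sign-not-minus (proj₁ asm i j)
    (sumF-zero⁻ _ (sumF-zero⁻ _ (trans (sym (σ₋-as-sum A)) σ≡0) i) j)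
  one-in : ∀ {v : Fin _ → ℤ} → (∀ j → Bit (v j)) → AltLine v → count (map v (allFin _)) 1ℤ ≡ 1
  one-in {v} bits-v (_ , total) = ℤP.+-injective (trans (count-ones v bits-v) total)

record Descent {n} (p : ℕ) (A : Matrix n) : Set where
  field
    D        : Fin (suc p) → Matrix n
    starts   : D fzero ≡ A
    asms     : ∀ t → IsASM (D t)
    defects  : ∀ t → σ₋ (D t) ≡ p ℕ.∸ toℕ t
    ends     : IsPermutationMatrix (D (fromℕ p))
    rising   : ∀ (t : Fin p) → h (D (inject₁ t)) ⪯* h (D (fsuc t))

prepend : ∀ {n p} {A A′ : Matrix n} → IsASM A → σ₋ A ≡ suc p → h A ⪯* h A′ →
  Descent p A′ → Descent (suc p) A
prepend {n} {p} {A} asm σ≡ up rest = record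
  { D = D′ ; starts = refl ; asms = asms′ ; defects = defects′ ; ends = ends ; rising = rising′ }
  where
  open Descent rest
  D′ : Fin (suc (suc p)) → Matrix n
  D′ fzero    = A
  D′ (fsuc t) = D t
  asms′ : ∀ t → IsASM (D′ t)
  asms′ fzero    = asm
  asms′ (fsuc t) = asms t
  defects′ : ∀ t → σ₋ (D′ t) ≡ suc p ℕ.∸ toℕ t
  defects′ fzero    = σ≡
  defects′ (fsuc t) = defects t
  rising′ : ∀ (t : Fin (suc p)) → h (D′ (inject₁ t)) ⪯* h (D′ (fsuc t))
  rising′ fzero    = subst (λ B → h A ⪯* h B) (sym starts) up
  rising′ (fsuc t) = rising t

descent : ∀ {n} p (A : Matrix n) → IsASM A → σ₋ A ≡ p → Descent p A
descent zero A asm σ≡0 = record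
  { D = λ _ → A ; starts = refl ; asms = λ _ → asm ; defects = λ { fzero → σ≡0 }
  ; ends = permutation A asm σ≡0 ; rising = λ () }
descent (suc p) A asm σ≡ =
  let (A′ , asm′ , σ′≡ , up) = reduce A asm σ≡ in prepend asm σ≡ up (descent p A′ asm′ σ′≡)

opposite-fromℕ : ∀ p → opposite (fromℕ p) ≡ fzero
opposite-fromℕ zero    = refl
opposite-fromℕ (suc p) = cong inject₁ (opposite-fromℕ p)

opposite-inject₁ : ∀ {p} (s : Fin p) → opposite (inject₁ s) ≡ fsuc (opposite s)
opposite-inject₁ fzero    = refl
opposite-inject₁ (fsuc s) = cong inject₁ (opposite-inject₁ s)

opposite-toℕ : ∀ {p} (s : Fin (suc p)) → p ℕ.∸ toℕ (opposite s) ≡ toℕ s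
opposite-toℕ {p} s =
  trans (cong (p ℕ.∸_) (FinP.opposite-prop s)) (ℕP.m∸[m∸n]≡n (ℕP.m<1+n⇒m≤n (FinP.toℕ<n s)))

-- The theorem: read the descent of length σ₋ A from the bottom, M s = D (p − s).
theorem3p8 : (n : ℕ) (A : Matrix n) → IsASM A →
    Σ (Fin (suc (σ₋ A)) → Matrix n) (λ M →
      ((s : Fin (suc (σ₋ A))) → IsASM (M s))
      × (M (fromℕ (σ₋ A)) ≡ A)
      × IsPermutationMatrix (M fzero)
      × ((s : Fin (suc (σ₋ A))) → σ₋ (M s) ≡ toℕ s)
      × ((s : Fin (σ₋ A)) → h (M (fsuc s)) ⪯* h (M (inject₁ s))))
theorem3p8 n A asm =
  D ∘ opposite ,
  asms ∘ opposite ,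
  trans (cong D (opposite-fromℕ (σ₋ A))) starts ,
  ends ,
  (λ s → trans (defects (opposite s)) (opposite-toℕ s)) ,
  (λ s → subst (λ t → h (D (inject₁ (opposite s))) ⪯* h (D t)) (sym (opposite-inject₁ s))
                (rising (opposite s)))
  where
  open Descent (descent (σ₋ A) A asm refl)
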